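{- Let $n$ be a positive integer and $p$ an odd prime with $p\mid n$. Let $S\subseteq\mathbb{Z}_n$ with $|S|=p$ be such that the Cayley sum graph $\mathrm{CS}(\mathbb{Z}_n,S)$ is connected and of degree $p$. Then $\mathrm{CS}(\mathbb{Z}_n,S)$ admits a total perfect code if and only if $s\not\equiv s'\pmod{p}$ for all distinct $s,s'\in S$.
   Context: For an abelian group $G$ and $S\subseteq G$, the Cayley sum graph $\mathrm{CS}(G,S)$ has vertex set $G$, two vertices $g,h$ adjacent iff $g+h\in S$ and $g\neq h$. A total perfect code of a graph is a set $C$ of vertices such that every vertex has exactly one neighbor in $C$. Elements of $\mathbb{Z}_n$ are identified with integers $0,\dots,n-1$. -}

module Defs where

open import Data.Nat using (ℕ; _+_; NonZero)
open import Data.Nat.DivMod using (_mod_)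
open import Data.Fin using (Fin; toℕ; _≟_)
open import Data.Fin.Subset using (Subset; _∈_; _∩_; ∣_∣)
open import Data.Fin.Subset.Properties using (_∈?_)
open import Data.Vec using (tabulate)
open import Data.Product using (_×_; ∃)
open import Relation.Binary.PropositionalEquality using (_≡_; _≢_)
open import Relation.Nullary using (Dec; does; ¬?)
open import Relation.Nullary.Decidable using (_×-dec_)

_⊕[_]_ : ∀ {n} → Fin n → (n : ℕ) → .{{NonZero n}} → Fin n → Fin n
(g ⊕[ n ] h) = (toℕ g + toℕ h) mod n

Adj : (n : ℕ) .{{_ : NonZero n}} → Subset n → Fin n → Fin n → Set
Adj n S g h = (g ≢ h) × ((g ⊕[ n ] h) ∈ S)

adj? : (n : ℕ) .{{_ : NonZero n}} (S : Subset n) (g h : Fin n) → Dec (Adj n S g h)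
adj? n S g h = ¬? (g ≟ h) ×-dec ((g ⊕[ n ] h) ∈? S)

N : (n : ℕ) .{{_ : NonZero n}} → Subset n → Fin n → Subset n
N n S g = tabulate (λ h → does (adj? n S g h))

Regular : (n : ℕ) .{{_ : NonZero n}} → Subset n → ℕ → Set
Regular n S d = ∀ g → ∣ N n S g ∣ ≡ d

data Reach (n : ℕ) .{{_ : NonZero n}} (S : Subset n) : Fin n → Fin n → Set where
  here : ∀ {g} → Reach n S g g
  step : ∀ {g h k} → Adj n S g h → Reach n S h k → Reach n S g k

Connected : (n : ℕ) .{{_ : NonZero n}} → Subset n → Set
Connected n S = ∀ g h → Reach n S g h

IsTotalPerfectCode : (n : ℕ) .{{_ : NonZero n}} → Subset n → Subset n → Set
IsTotalPerfectCode n S C = ∀ g → ∣ N n S g ∩ C ∣ ≡ 1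

HasTotalPerfectCode : (n : ℕ) .{{_ : NonZero n}} → Subset n → Set
HasTotalPerfectCode n S = ∃ λ C → IsTotalPerfectCode n S C

-- Regularity of degree |S| means that no g has g + g ∈ S, so the neighbours of g are exactly the h with
-- g + h ∈ S, and a total perfect code C is the same as a tiling ℤ_n = S ⊕ (−C).
--
-- (⇒) In the semiring ℕ[X] of shift operators the freshman's dream gives (Σ_{s∈S} X^s)^p ≡ Σ_{s∈S} X^{ps}
-- modulo p. Applied to the indicator of C the left side is the constant p^(p−1), so every count
-- #{s ∈ S : x + ps ∈ C} is 0 or p: C is invariant under translation by p(b − a) for a, b ∈ S.
-- Without loops n is even and every element of S is odd; a walk from 0 to 2 in the connected graph then
-- shows that 2 lies in the subgroup generated by S − S, so 2p is a period of C. Two elements a < b of S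
-- with a ≡ b (mod p) differ by an even multiple of p, hence by a period of C, and the tiling would cover
-- some element twice.
--
-- (⇐) Take C = pℤ_n. The neighbours of g in C correspond to the s ∈ S with s ≡ g (mod p), and p elements
-- of S with distinct residues modulo p meet every residue class exactly once.

module Submission where

open import Algebra.Bundles using (Semiring)

module PrimeBinomial where

  open import Data.Nat using (ℕ; zero; suc; _*_; _∸_; _≤_; _<_; _!; NonZero)
  open import Data.Nat.Properties using (m≤n⇒m≤1+n; <⇒≤; <⇒≱; ∸-monoʳ-<; _!*_!≢0)
  open import Data.Nat.DivMod using (_/_; m/n*n≡m)
  open import Data.Nat.Divisibility using (_∣_; ∣⇒≤; ∣1⇒≡1; m∣m*n)
  open import Data.Nat.Primality using (Prime; euclidsLemma; ¬prime[1])
  open import Data.Nat.Combinatorics using (_C_; nCk≡n!/k![n-k]!; k![n∸k]!∣n!)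
  open import Data.Sum using (inj₁; inj₂)
  open import Relation.Binary.PropositionalEquality using (_≡_; cong; subst; sym; module ≡-Reasoning)
  open import Relation.Nullary using (contradiction)

  private variable
    p k m : ℕ

  prime∣n!⇒≤ : Prime p → p ∣ m ! → p ≤ m
  prime∣n!⇒≤ {m = zero}  pr p∣1  = contradiction (subst Prime (∣1⇒≡1 p∣1) pr) ¬prime[1]
  prime∣n!⇒≤ {m = suc m} pr p∣m! with euclidsLemma (suc m) (m !) pr p∣m!
  ... | inj₁ p∣1+m = ∣⇒≤ p∣1+m
  ... | inj₂ p∣m!  = m≤n⇒m≤1+n (prime∣n!⇒≤ pr p∣m!)

  nCk*k!*[n∸k]!≡n! : ∀ {n k} → k ≤ n → (n C k) * (k ! * (n ∸ k) !) ≡ n !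
  nCk*k!*[n∸k]!≡n! {n} {k} k≤n = begin
    (n C k) * (k ! * (n ∸ k) !)                  ≡⟨ cong (_* (k ! * (n ∸ k) !)) (nCk≡n!/k![n-k]! k≤n) ⟩
    n ! / (k ! * (n ∸ k) !) * (k ! * (n ∸ k) !)  ≡⟨ m/n*n≡m (k![n∸k]!∣n! k≤n) ⟩
    n !                                          ∎
    where
    open ≡-Reasoning
    instance
      k!*[n∸k]!≢0 : NonZero (k ! * (n ∸ k) !)
      k!*[n∸k]!≢0 = k !* (n ∸ k) !≢0

  prime∣pCk : Prime p → 0 < k → k < p → p ∣ p C k
  prime∣pCk {p@(suc q)} {k} pr 0<k k<p
    with euclidsLemma (p C k) (k ! * (p ∸ k) !) pr (subst (p ∣_) (sym (nCk*k!*[n∸k]!≡n! (<⇒≤ k<p))) (m∣m*n (q !)))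
  ... | inj₁ p∣pCk = p∣pCk
  ... | inj₂ p∣k!*[p∸k]! with euclidsLemma (k !) ((p ∸ k) !) pr p∣k!*[p∸k]!
  ...   | inj₁ p∣k!     = contradiction (prime∣n!⇒≤ pr p∣k!) (<⇒≱ k<p)
  ...   | inj₂ p∣[p∸k]! = contradiction (prime∣n!⇒≤ pr p∣[p∸k]!) (<⇒≱ (∸-monoʳ-< 0<k (<⇒≤ k<p)))

-- Stated before the main imports, whose arithmetic names would clash with the fields of R.
module FreshmansDream {c ℓ} (R : Semiring c ℓ) where

  open Semiring R
  open import Algebra.Properties.Semiring.Mult R using (_×_; ×-assocˡ; ×-homo-1)
  open import Algebra.Properties.Semiring.Exp R using (_^_)
  open import Algebra.Properties.Monoid.Sum +-monoid using (sum; sum-init-last; sum-cong-≋)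
  open import Algebra.Properties.CommutativeMonoid.Mult +-commutativeMonoid using (×-distrib-+)
  open import Data.Nat as ℕ using (ℕ; zero; suc; _∸_; z<s; s<s)
  open import Data.Nat.Properties using (n∸n≡0)
  open import Data.Nat.DivMod using (_/_; m*[n/m]≡n)
  open import Data.Nat.Primality using (Prime; prime⇒nonZero)
  open import Data.Nat.Combinatorics using (_C_; nCn≡1)
  open import Data.Fin as Fin using (Fin; toℕ; inject₁; fromℕ)
  open import Data.Fin.Properties using (toℕ-fromℕ; toℕ-inject₁; toℕ<n)
  open import Data.Product using (∃-syntax; _,_)
  open import Function using (_∘_)
  import Relation.Binary.PropositionalEquality as ≡
  open import Relation.Binary.Reasoning.Setoid setoid
  open PrimeBinomial using (prime∣pCk)

  ×-zeroʳ : ∀ m → m × 0# ≈ 0#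
  ×-zeroʳ zero    = refl
  ×-zeroʳ (suc m) = trans (+-identityˡ _) (×-zeroʳ m)

  ×-distrib-sum : ∀ m {k} (w : Fin k → Carrier) → m × sum w ≈ sum (λ i → m × w i)
  ×-distrib-sum m {zero}  w = ×-zeroʳ m
  ×-distrib-sum m {suc k} w =
    trans (×-distrib-+ (w Fin.zero) (sum (w ∘ Fin.suc)) m) (+-congˡ (×-distrib-sum m (w ∘ Fin.suc)))

  module _ {x y : Carrier} (x*y≈y*x : x * y ≈ y * x) where

    open import Algebra.Properties.Semiring.Binomial R x y using (binomialTerm; theorem)

    -- z collects the quotients (p C k) / p of the middle binomial coefficients.
    freshmans-dream : ∀ {p} → Prime p → ∃[ z ] (x + y) ^ p ≈ x ^ p + y ^ p + p × z
    freshmans-dream {p@(suc (suc r))} pr = sum w , (begin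
      (x + y) ^ p                                        ≈⟨ theorem x*y≈y*x p ⟩
      T Fin.zero + sum (T ∘ Fin.suc)                     ≈⟨ +-congˡ (sum-init-last (T ∘ Fin.suc)) ⟩
      T Fin.zero + (sum middle + T (Fin.suc (fromℕ (suc r)))) ≈⟨ +-cong first (+-cong middle≈ last) ⟩
      y ^ p + (p × sum w + x ^ p)                        ≈⟨ +-congˡ (+-comm _ _) ⟩
      y ^ p + (x ^ p + p × sum w)                        ≈⟨ sym (+-assoc _ _ _) ⟩
      y ^ p + x ^ p + p × sum w                          ≈⟨ +-congʳ (+-comm _ _) ⟩
      x ^ p + y ^ p + p × sum w                          ∎)
      where
      instance
        p≢0 : ℕ.NonZero p
        p≢0 = prime⇒nonZero pr
      T : Fin (suc p) → Carrier
      T = binomialTerm p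
      k : Fin (suc r) → ℕ
      k j = suc (toℕ (inject₁ j))
      middle w : Fin (suc r) → Carrier
      middle j = T (Fin.suc (inject₁ j))
      w j = ((p C k j) / p) × (x ^ k j * y ^ (p ∸ k j))
      middle-term : ∀ j → middle j ≈ p × w j
      middle-term j = begin
        (p C k j) × b                ≡⟨ ≡.cong (_× b) (≡.sym (m*[n/m]≡n (prime∣pCk pr z<s (s<s k<)))) ⟩
        (p ℕ.* ((p C k j) / p)) × b  ≈⟨ sym (×-assocˡ b p ((p C k j) / p)) ⟩
        p × w j                      ∎
        where
        b : Carrier
        b = x ^ k j * y ^ (p ∸ k j)
        k< : toℕ (inject₁ j) ℕ.< suc r
        k< = ≡.subst (ℕ._< suc r) (≡.sym (toℕ-inject₁ j)) (toℕ<n j)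
      middle≈ : sum middle ≈ p × sum w
      middle≈ = trans (sum-cong-≋ middle-term) (sym (×-distrib-sum p w))
      first : T Fin.zero ≈ y ^ p
      first = trans (×-homo-1 _) (*-identityˡ _)
      last : T (Fin.suc (fromℕ (suc r))) ≈ x ^ p
      last = begin
        T (Fin.suc (fromℕ (suc r)))       ≡⟨ ≡.cong (λ i → (p C suc i) × (x ^ suc i * y ^ (p ∸ suc i))) (toℕ-fromℕ (suc r)) ⟩
        (p C p) × (x ^ p * y ^ (p ∸ p))   ≡⟨ ≡.cong₂ (λ c e → c × (x ^ p * y ^ e)) (nCn≡1 p) (n∸n≡0 p) ⟩
        1 × (x ^ p * 1#)                  ≈⟨ trans (×-homo-1 _) (*-identityʳ _) ⟩
        x ^ p                             ∎

open import Defs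
open import Data.Bool using (Bool; true; false; not; _∧_; if_then_else_)
open import Data.Nat using (ℕ; zero; suc; pred; _+_; _*_; _^_; _∸_; _≤_; _<_; z≤n; s≤s; z<s; s<s; NonZero; >-nonZero⁻¹; _%_)
open import Data.Nat.Properties
  using ( +-comm; +-assoc; +-identityʳ; +-suc; *-comm; *-zeroʳ; *-identityʳ; *-suc; *-distribˡ-+
        ; *-distribʳ-∸; suc-injective; suc-pred; +-cancelˡ-≡; +-cancelʳ-≤; +-mono-≤; +-monoʳ-≤; +-monoˡ-≤
        ; ≤-refl; ≤-trans; ≤-antisym; <⇒≤; <-irrefl; <-cmp; m≤m+n; m≤n+m; m+[n∸m]≡n; [m+n]∸[m+o]≡n∸o
        ; +-commutativeSemigroup; _≟_; module ≤-Reasoning )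
open import Algebra.Properties.CommutativeSemigroup +-commutativeSemigroup using (interchange)
open import Data.Nat.DivMod
  using ( _mod_; _/_; m≡m%n+[m/n]*n; m%n<n; m%n%n≡m%n; m<n⇒m%n≡m; [m+n]%n≡m%n; [m+kn]%n≡m%n
        ; %-distribˡ-+; %-distribˡ-*; %-pred-≡0; m∣n⇒o%n%m≡o%m )
open import Data.Nat.Divisibility
  using (_∣_; _∣?_; divides; m∣m*n; ∣m+n∣m⇒∣n; n∣m⇒m%n≡0; m%n≡0⇒n∣m; %-presˡ-∣; ∣n∣m%n⇒∣m)
open import Data.Nat.Primality using (Prime)
open import Data.Nat.Tactic.RingSolver using (solve-∀)
open import Data.Fin as Fin using (Fin; toℕ)
open import Data.Fin.Properties using (toℕ-injective; toℕ-fromℕ<; toℕ<n)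
open import Data.Fin.Subset using (Subset; _∈_; _∩_; ∣_∣)
open import Data.Fin.Subset.Properties using (_∈?_)
open import Data.List using (List; []; _∷_; _++_; map; length)
open import Data.List.Properties using (++-assoc; ++-identityʳ; map-++; map-id; length-map)
open import Data.Vec using (Vec; []; _∷_; lookup; tabulate)
open import Data.Vec.Properties using (lookup-zipWith; lookup∘tabulate; []=⇒lookup; lookup⇒[]=)
open import Data.Product using (∃-syntax; _×_; _,_; proj₁; proj₂)
open import Data.Sum as Sum using (_⊎_; inj₁; inj₂; swap)
open import Data.Empty using (⊥)
open import Function using (_∘_; id)
open import Function.Bundles using (_⇔_; mk⇔)
open import Level using (0ℓ)
open import Relation.Binary.Bundles using (Setoid)
open import Relation.Binary.Definitions using (tri<; tri≈; tri>)
open import Relation.Binary.PropositionalEquality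
  using (_≡_; _≢_; refl; sym; trans; cong; cong₂; subst; subst₂; module ≡-Reasoning)
open import Relation.Nullary using (Dec; does; yes; no; contradiction)
open import Relation.Nullary.Decidable using (dec-true; dec-false; does-⇔)
open FreshmansDream using (freshmans-dream)

private variable
  f f′ : ℕ → ℕ

∑ : ℕ → (ℕ → ℕ) → ℕ
∑ zero    f = 0
∑ (suc n) f = f 0 + ∑ n (f ∘ suc)

infix 5 ∑
syntax ∑ n (λ i → e) = ∑[ i < n ] e

∑-cong : ∀ n → (∀ i → i < n → f i ≡ f′ i) → ∑ n f ≡ ∑ n f′
∑-cong zero    eq = refl
∑-cong (suc n) eq = cong₂ _+_ (eq 0 z<s) (∑-cong n (λ i i<n → eq (suc i) (s<s i<n)))

∑-mono-≤ : ∀ n → (∀ i → i < n → f i ≤ f′ i) → ∑ n f ≤ ∑ n f′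
∑-mono-≤ zero    le = z≤n
∑-mono-≤ (suc n) le = +-mono-≤ (le 0 z<s) (∑-mono-≤ n (λ i i<n → le (suc i) (s<s i<n)))

∑-const : ∀ n c → ∑[ i < n ] c ≡ n * c
∑-const zero    c = refl
∑-const (suc n) c = cong (c +_) (∑-const n c)

∑-+ : ∀ n f g → ∑[ i < n ] (f i + g i) ≡ ∑ n f + ∑ n g
∑-+ zero    f g = refl
∑-+ (suc n) f g = trans (cong (f 0 + g 0 +_) (∑-+ n (f ∘ suc) (g ∘ suc))) (interchange (f 0) (g 0) _ _)

∑-*ˡ : ∀ n c f → ∑[ i < n ] (c * f i) ≡ c * ∑ n f
∑-*ˡ zero    c f = sym (*-zeroʳ c)
∑-*ˡ (suc n) c f = trans (cong (c * f 0 +_) (∑-*ˡ n c (f ∘ suc))) (sym (*-distribˡ-+ c (f 0) _))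

∑-comm : ∀ m n (F : ℕ → ℕ → ℕ) → ∑[ i < m ] ∑[ j < n ] F i j ≡ ∑[ j < n ] ∑[ i < m ] F i j
∑-comm zero    n F = sym (trans (∑-const n 0) (*-zeroʳ n))
∑-comm (suc m) n F = trans (cong (∑ n (F 0) +_) (∑-comm m n (F ∘ suc)))
                           (sym (∑-+ n (F 0) (λ j → ∑[ i < m ] F (suc i) j)))

∑-last : ∀ n f → ∑ (suc n) f ≡ ∑ n f + f n
∑-last zero    f = +-comm (f 0) 0
∑-last (suc n) f = trans (cong (f 0 +_) (∑-last n (f ∘ suc))) (sym (+-assoc (f 0) _ _))

∑-periodic-shift : ∀ n f → (∀ x → f (x + n) ≡ f x) → ∀ k → ∑[ i < n ] f (i + k) ≡ ∑ n f
∑-periodic-shift n f periodic zero    = ∑-cong n (λ i _ → cong f (+-identityʳ i))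
∑-periodic-shift n f periodic (suc k) = begin
  ∑[ i < n ] f (i + suc k)       ≡⟨ ∑-cong n (λ i _ → cong f (+-suc i k)) ⟩
  ∑ n (fₖ ∘ suc)                 ≡⟨ +-cancelˡ-≡ (fₖ 0) _ _ rotate ⟩
  ∑ n fₖ                         ≡⟨ ∑-periodic-shift n f periodic k ⟩
  ∑ n f                          ∎
  where
  open ≡-Reasoning
  fₖ : ℕ → ℕ
  fₖ i = f (i + k)
  -- The term fₖ n entering the window equals the term fₖ 0 leaving it.
  rotate : fₖ 0 + ∑ n (fₖ ∘ suc) ≡ fₖ 0 + ∑ n fₖ
  rotate = trans (∑-last n fₖ) (trans (cong (∑ n fₖ +_) (trans (cong f (+-comm n k)) (periodic k)))
                                      (+-comm (∑ n fₖ) (fₖ 0)))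

term≤∑ : ∀ n f {a} → a < n → f a ≤ ∑ n f
term≤∑ (suc n) f {zero}  _         = m≤m+n (f 0) _
term≤∑ (suc n) f {suc a} (s<s a<n) = ≤-trans (term≤∑ n (f ∘ suc) a<n) (m≤n+m _ (f 0))

two-terms≤∑ : ∀ n f {a b} → a < b → b < n → f a + f b ≤ ∑ n f
two-terms≤∑ (suc n) f {zero}  {suc b} _         (s<s b<n) = +-monoʳ-≤ (f 0) (term≤∑ n (f ∘ suc) b<n)
two-terms≤∑ (suc n) f {suc a} {suc b} (s<s a<b) (s<s b<n) =
  ≤-trans (two-terms≤∑ n (f ∘ suc) a<b b<n) (m≤n+m _ (f 0))

∑-positive : ∀ n f → 0 < ∑ n f → ∃[ i ] i < n × 0 < f i
∑-positive (suc n) f pos with f 0 in f0≡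
... | suc _ = 0 , z<s , subst (0 <_) (sym f0≡) z<s
... | zero with ∑-positive n (f ∘ suc) pos
...   | i , i<n , fi>0 = suc i , s<s i<n , fi>0

∑-supported : ∀ n f {a} → a < n → (∀ i → i < n → i ≢ a → f i ≡ 0) → ∑ n f ≡ f a
∑-supported (suc n) f {zero} _ vanish =
  trans (cong (f 0 +_) (trans (∑-cong n (λ i i<n → vanish (suc i) (s<s i<n) λ ())) (trans (∑-const n 0) (*-zeroʳ n))))
        (+-identityʳ (f 0))
∑-supported (suc n) f {suc a} (s<s a<n) vanish =
  trans (cong (_+ ∑ n (f ∘ suc)) (vanish 0 z<s λ ()))
        (∑-supported n (f ∘ suc) a<n (λ i i<n i≢a → vanish (suc i) (s<s i<n) (i≢a ∘ suc-injective)))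

∑-≤1 : ∀ n f → (∀ i → i < n → f i ≤ 1) → (∀ i j → i < n → j < n → 0 < f i → 0 < f j → i ≡ j) → ∑ n f ≤ 1
∑-≤1 n f ≤1 unique with ∑ n f in sum≡
... | zero  = z≤n
... | suc _ with ∑-positive n f (subst (0 <_) (sym sum≡) z<s)
...   | a , a<n , fa>0 = subst (_≤ 1) (trans (sym (∑-supported n f a<n vanish)) sum≡) (≤1 a a<n)
  where
  vanish : ∀ i → i < n → i ≢ a → f i ≡ 0
  vanish i i<n i≢a with f i in fi≡
  ... | zero  = refl
  ... | suc _ = contradiction (unique i a i<n a<n (subst (0 <_) (sym fi≡) z<s) fa>0) i≢a

tight-≤-pair : ∀ {a b c d} → a ≤ b → c ≤ d → a + c ≡ b + d → a ≡ b × c ≡ d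
tight-≤-pair {a} {b} {c} {d} a≤b c≤d eq = a≡b , +-cancelˡ-≡ b c d (trans (cong (_+ c) (sym a≡b)) eq)
  where
  a≡b : a ≡ b
  a≡b = ≤-antisym a≤b (+-cancelʳ-≤ d b a (subst (_≤ a + d) eq (+-monoʳ-≤ a c≤d)))

∑-pointwise-≡ : ∀ n → (∀ i → i < n → f i ≤ f′ i) → ∑ n f ≡ ∑ n f′ → ∀ i → i < n → f i ≡ f′ i
∑-pointwise-≡ (suc n) le eq i i<n with tight-≤-pair (le 0 z<s) (∑-mono-≤ n (λ i i<n → le (suc i) (s<s i<n))) eq
∑-pointwise-≡ (suc n) le eq zero    _         | f0≡g0 , _     = f0≡g0
∑-pointwise-≡ (suc n) le eq (suc i) (s<s i<n) | _     , rest≡ = ∑-pointwise-≡ n (λ i i<n → le (suc i) (s<s i<n)) rest≡ i i<n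

𝟙 : Bool → ℕ
𝟙 true  = 1
𝟙 false = 0

𝟙-∧ : ∀ a b → 𝟙 (a ∧ b) ≡ 𝟙 a * 𝟙 b
𝟙-∧ true  b = sym (+-identityʳ (𝟙 b))
𝟙-∧ false b = refl

𝟙-∧-≤ : ∀ a b → 𝟙 (a ∧ b) ≤ 𝟙 b
𝟙-∧-≤ true  b = ≤-refl
𝟙-∧-≤ false b = z≤n

𝟙≤1 : ∀ b → 𝟙 b ≤ 1
𝟙≤1 true  = s≤s z≤n
𝟙≤1 false = z≤n

𝟙*≤𝟙 : ∀ a {c} → c ≤ 1 → 𝟙 a * c ≤ 𝟙 a
𝟙*≤𝟙 true  c≤1 = +-monoˡ-≤ 0 c≤1
𝟙*≤𝟙 false _   = z≤n

𝟙≡0⇒false : ∀ {b} → 𝟙 b ≡ 0 → b ≡ false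
𝟙≡0⇒false {false} _ = refl

𝟙≡1⇒true : ∀ {b} → 𝟙 b ≡ 1 → b ≡ true
𝟙≡1⇒true {true} _ = refl

𝟙>0⇒true : ∀ {b} → 0 < 𝟙 b → b ≡ true
𝟙>0⇒true {true} _ = refl

𝟙*𝟙>0⇒true : ∀ a b → 0 < 𝟙 a * 𝟙 b → a ≡ true × b ≡ true
𝟙*𝟙>0⇒true true true _ = refl , refl

does⇒ : ∀ {A : Set} (a? : Dec A) → does a? ≡ true → A
does⇒ (yes a) _ = a

infix 4 _≡_[mod_]

-- A record rather than a synonym for x % d ≡ y % d, so that x and y can be inferred.
record _≡_[mod_] (x y d : ℕ) .{{_ : NonZero d}} : Set where
  constructor mod-eq
  field %-eq : x % d ≡ y % d

open _≡_[mod_]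

module _ {d : ℕ} .{{_ : NonZero d}} where

  private variable
    a a′ b b′ x y z : ℕ

  ≡-mod-refl : x ≡ x [mod d ]
  ≡-mod-refl = mod-eq refl

  ≡⇒≡-mod : x ≡ y → x ≡ y [mod d ]
  ≡⇒≡-mod x≡y = mod-eq (cong (_% d) x≡y)

  ≡-mod-sym : x ≡ y [mod d ] → y ≡ x [mod d ]
  ≡-mod-sym (mod-eq e) = mod-eq (sym e)

  ≡-mod-trans : x ≡ y [mod d ] → y ≡ z [mod d ] → x ≡ z [mod d ]
  ≡-mod-trans (mod-eq e) (mod-eq e′) = mod-eq (trans e e′)

  ≡-mod-setoid : Setoid 0ℓ 0ℓ
  ≡-mod-setoid = record
    { Carrier       = ℕ
    ; _≈_           = _≡_[mod d ]
    ; isEquivalence = record { refl = ≡-mod-refl ; sym = ≡-mod-sym ; trans = ≡-mod-trans }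
    }

  +-cong-mod : a ≡ a′ [mod d ] → b ≡ b′ [mod d ] → a + b ≡ a′ + b′ [mod d ]
  +-cong-mod {a} {a′} {b} {b′} (mod-eq ea) (mod-eq eb) = mod-eq (begin
    (a + b) % d              ≡⟨ %-distribˡ-+ a b d ⟩
    (a % d + b % d) % d      ≡⟨ cong₂ (λ u v → (u + v) % d) ea eb ⟩
    (a′ % d + b′ % d) % d    ≡⟨ %-distribˡ-+ a′ b′ d ⟨
    (a′ + b′) % d            ∎)
    where open ≡-Reasoning

  *-cong-mod : a ≡ a′ [mod d ] → b ≡ b′ [mod d ] → a * b ≡ a′ * b′ [mod d ]
  *-cong-mod {a} {a′} {b} {b′} (mod-eq ea) (mod-eq eb) = mod-eq (begin
    (a * b) % d              ≡⟨ %-distribˡ-* a b d ⟩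
    (a % d * (b % d)) % d    ≡⟨ cong₂ (λ u v → (u * v) % d) ea eb ⟩
    (a′ % d * (b′ % d)) % d  ≡⟨ %-distribˡ-* a′ b′ d ⟨
    (a′ * b′) % d            ∎)
    where open ≡-Reasoning

  +-congˡ-mod : ∀ a → b ≡ b′ [mod d ] → a + b ≡ a + b′ [mod d ]
  +-congˡ-mod a = +-cong-mod (≡-mod-refl {a})

  +-congʳ-mod : ∀ b → a ≡ a′ [mod d ] → a + b ≡ a′ + b [mod d ]
  +-congʳ-mod b eq = +-cong-mod eq (≡-mod-refl {b})

  *-congˡ-mod : ∀ a → b ≡ b′ [mod d ] → a * b ≡ a * b′ [mod d ]
  *-congˡ-mod a = *-cong-mod (≡-mod-refl {a})

  %-mod : ∀ x → x % d ≡ x [mod d ]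
  %-mod x = mod-eq (m%n%n≡m%n x d)

  +-modulus-mod : ∀ x → x + d ≡ x [mod d ]
  +-modulus-mod x = mod-eq ([m+n]%n≡m%n x d)

  +-multiple-mod : ∀ x k → x + k * d ≡ x [mod d ]
  +-multiple-mod x k = mod-eq ([m+kn]%n≡m%n x k d)

  ∣⇒≡0-mod : d ∣ x → x ≡ 0 [mod d ]
  ∣⇒≡0-mod {x} d∣x = mod-eq (trans (n∣m⇒m%n≡0 x d d∣x) (sym (m<n⇒m%n≡m (>-nonZero⁻¹ d))))

  ≡0-mod⇒∣ : x ≡ 0 [mod d ] → d ∣ x
  ≡0-mod⇒∣ {x} (mod-eq eq) = m%n≡0⇒n∣m x d (trans eq (m<n⇒m%n≡m (>-nonZero⁻¹ d)))

  divisor-mod : ∀ {e} .{{_ : NonZero e}} → e ∣ d → x ≡ y [mod d ] → x ≡ y [mod e ]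
  divisor-mod {x} {y} {e} e∣d (mod-eq eq) =
    mod-eq (trans (sym (m∣n⇒o%n%m≡o%m e d x e∣d)) (trans (cong (_% e) eq) (m∣n⇒o%n%m≡o%m e d y e∣d)))

  ≡-mod⇒∣∸ : x ≡ y [mod d ] → d ∣ y ∸ x
  ≡-mod⇒∣∸ {x} {y} (mod-eq eq) = divides (y / d ∸ x / d) (begin
    y ∸ x                                     ≡⟨ cong₂ _∸_ (m≡m%n+[m/n]*n y d) (m≡m%n+[m/n]*n x d) ⟩
    (y % d + y / d * d) ∸ (x % d + x / d * d) ≡⟨ cong (λ r → (r + y / d * d) ∸ (x % d + x / d * d)) (sym eq) ⟩
    (x % d + y / d * d) ∸ (x % d + x / d * d) ≡⟨ [m+n]∸[m+o]≡n∸o (x % d) _ _ ⟩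
    y / d * d ∸ x / d * d                     ≡⟨ *-distribʳ-∸ d (y / d) (x / d) ⟨
    (y / d ∸ x / d) * d                       ∎)
    where open ≡-Reasoning

even-or-odd : ∀ t → t ≡ 0 [mod 2 ] ⊎ t ≡ 1 [mod 2 ]
even-or-odd t with t % 2 in eq | m%n<n t 2
... | 0           | _             = inj₁ (mod-eq eq)
... | 1           | _             = inj₂ (mod-eq eq)
... | suc (suc _) | s<s (s<s ())

odd+odd : ∀ {a b} → a ≡ 1 [mod 2 ] → b ≡ 1 [mod 2 ] → a + b ≡ 0 [mod 2 ]
odd+odd oa ob = ≡-mod-trans (+-cong-mod oa ob) (mod-eq refl)

odd*odd : ∀ {a b} → a ≡ 1 [mod 2 ] → b ≡ 1 [mod 2 ] → a * b ≡ 1 [mod 2 ]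
odd*odd oa ob = ≡-mod-trans (*-cong-mod oa ob) (mod-eq refl)

even⇒[t/2]*2≡t : ∀ {t} → t ≡ 0 [mod 2 ] → t / 2 * 2 ≡ t
even⇒[t/2]*2≡t {t} (mod-eq even) = sym (trans (m≡m%n+[m/n]*n t 2) (cong (_+ t / 2 * 2) even))

does-∈? : ∀ {k} (x : Fin k) (S : Subset k) → does (x ∈? S) ≡ lookup S x
does-∈? Fin.zero    (true  ∷ S) = refl
does-∈? Fin.zero    (false ∷ S) = refl
does-∈? (Fin.suc x) (b ∷ S)     = does-∈? x S

count-lookup : ∀ {k} (v : Vec Bool k) f → (∀ i → f (toℕ i) ≡ 𝟙 (lookup v i)) → ∣ v ∣ ≡ ∑ k f
count-lookup []          f eq = refl
count-lookup (true ∷ v)  f eq = cong₂ _+_ (sym (eq Fin.zero)) (count-lookup v (f ∘ suc) (eq ∘ Fin.suc))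
count-lookup (false ∷ v) f eq = cong₂ _+_ (sym (eq Fin.zero)) (count-lookup v (f ∘ suc) (eq ∘ Fin.suc))

-- A list L of shifts stands for the element Σ_{t ∈ L} X^t of the semiring ℕ[X]; ⟦ L ⟧ is its action on
-- functions ℕ → ℕ, X^t acting as translation by t.
Shifts : Set
Shifts = List ℕ

⟦_⟧ : Shifts → (ℕ → ℕ) → ℕ → ℕ
⟦ []    ⟧ h x = 0
⟦ t ∷ L ⟧ h x = h (x + t) + ⟦ L ⟧ h x

infixr 7 _⊛_
infix  4 _≈ₛ_

_⊛_ : Shifts → Shifts → Shifts
[]      ⊛ M = []
(s ∷ L) ⊛ M = map (s +_) M ++ L ⊛ M

_≈ₛ_ : Shifts → Shifts → Set
L ≈ₛ M = ∀ h x → ⟦ L ⟧ h x ≡ ⟦ M ⟧ h x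

⟦⟧-cong : ∀ L {h h′} → (∀ y → h y ≡ h′ y) → ∀ x → ⟦ L ⟧ h x ≡ ⟦ L ⟧ h′ x
⟦⟧-cong []      eq x = refl
⟦⟧-cong (t ∷ L) eq x = cong₂ _+_ (eq (x + t)) (⟦⟧-cong L eq x)

⟦⟧-++ : ∀ L M h x → ⟦ L ++ M ⟧ h x ≡ ⟦ L ⟧ h x + ⟦ M ⟧ h x
⟦⟧-++ []      M h x = refl
⟦⟧-++ (t ∷ L) M h x = trans (cong (h (x + t) +_) (⟦⟧-++ L M h x)) (sym (+-assoc (h (x + t)) _ _))

⟦⟧-+ : ∀ L h h′ x → ⟦ L ⟧ (λ y → h y + h′ y) x ≡ ⟦ L ⟧ h x + ⟦ L ⟧ h′ x
⟦⟧-+ []      h h′ x = refl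
⟦⟧-+ (t ∷ L) h h′ x = trans (cong (h (x + t) + h′ (x + t) +_) (⟦⟧-+ L h h′ x)) (interchange (h (x + t)) (h′ (x + t)) _ _)

⟦⟧-const : ∀ L c x → ⟦ L ⟧ (λ _ → c) x ≡ length L * c
⟦⟧-const []      c x = refl
⟦⟧-const (t ∷ L) c x = cong (c +_) (⟦⟧-const L c x)

⟦⟧-≤-length : ∀ L {φ} → (∀ y → φ y ≤ 1) → ∀ x → ⟦ L ⟧ φ x ≤ length L
⟦⟧-≤-length []      φ≤1 x = z≤n
⟦⟧-≤-length (t ∷ L) φ≤1 x = +-mono-≤ (φ≤1 (x + t)) (⟦⟧-≤-length L φ≤1 x)

⟦⟧-translate : ∀ L h s x → ⟦ L ⟧ (λ y → h (y + s)) x ≡ ⟦ L ⟧ h (x + s)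
⟦⟧-translate []      h s x = refl
⟦⟧-translate (t ∷ L) h s x = cong₂ _+_ (cong h (x+t+s≡x+s+t x t s)) (⟦⟧-translate L h s x)
  where
  x+t+s≡x+s+t : ∀ x t s → x + t + s ≡ x + s + t
  x+t+s≡x+s+t = solve-∀

⟦⟧-map-+ : ∀ s M h x → ⟦ map (s +_) M ⟧ h x ≡ ⟦ M ⟧ h (x + s)
⟦⟧-map-+ s []      h x = refl
⟦⟧-map-+ s (t ∷ M) h x = cong₂ _+_ (cong h (sym (+-assoc x s t))) (⟦⟧-map-+ s M h x)

⟦⟧-⊛ : ∀ L M h x → ⟦ L ⊛ M ⟧ h x ≡ ⟦ L ⟧ (⟦ M ⟧ h) x
⟦⟧-⊛ []      M h x = refl
⟦⟧-⊛ (s ∷ L) M h x = begin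
  ⟦ map (s +_) M ++ L ⊛ M ⟧ h x               ≡⟨ ⟦⟧-++ (map (s +_) M) (L ⊛ M) h x ⟩
  ⟦ map (s +_) M ⟧ h x + ⟦ L ⊛ M ⟧ h x        ≡⟨ cong₂ _+_ (⟦⟧-map-+ s M h x) (⟦⟧-⊛ L M h x) ⟩
  ⟦ M ⟧ h (x + s) + ⟦ L ⟧ (⟦ M ⟧ h) x         ∎
  where open ≡-Reasoning

++-cong-≈ₛ : ∀ {L L′ M M′} → L ≈ₛ L′ → M ≈ₛ M′ → L ++ M ≈ₛ L′ ++ M′
++-cong-≈ₛ {L} {L′} {M} {M′} L≈ M≈ h x =
  trans (⟦⟧-++ L M h x) (trans (cong₂ _+_ (L≈ h x) (M≈ h x)) (sym (⟦⟧-++ L′ M′ h x)))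

++-comm-≈ₛ : ∀ L M → L ++ M ≈ₛ M ++ L
++-comm-≈ₛ L M h x = trans (⟦⟧-++ L M h x) (trans (+-comm (⟦ L ⟧ h x) _) (sym (⟦⟧-++ M L h x)))

⊛-cong : ∀ {L L′ M M′} → L ≈ₛ L′ → M ≈ₛ M′ → L ⊛ M ≈ₛ L′ ⊛ M′
⊛-cong {L} {L′} {M} {M′} L≈ M≈ h x = begin
  ⟦ L ⊛ M ⟧ h x            ≡⟨ ⟦⟧-⊛ L M h x ⟩
  ⟦ L ⟧ (⟦ M ⟧ h) x        ≡⟨ ⟦⟧-cong L (M≈ h) x ⟩
  ⟦ L ⟧ (⟦ M′ ⟧ h) x       ≡⟨ L≈ (⟦ M′ ⟧ h) x ⟩
  ⟦ L′ ⟧ (⟦ M′ ⟧ h) x      ≡⟨ ⟦⟧-⊛ L′ M′ h x ⟨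
  ⟦ L′ ⊛ M′ ⟧ h x          ∎
  where open ≡-Reasoning

⊛-assoc : ∀ L M K → (L ⊛ M) ⊛ K ≈ₛ L ⊛ (M ⊛ K)
⊛-assoc L M K h x = begin
  ⟦ (L ⊛ M) ⊛ K ⟧ h x       ≡⟨ ⟦⟧-⊛ (L ⊛ M) K h x ⟩
  ⟦ L ⊛ M ⟧ (⟦ K ⟧ h) x     ≡⟨ ⟦⟧-⊛ L M (⟦ K ⟧ h) x ⟩
  ⟦ L ⟧ (⟦ M ⟧ (⟦ K ⟧ h)) x ≡⟨ ⟦⟧-cong L (λ y → ⟦⟧-⊛ M K h y) x ⟨
  ⟦ L ⟧ (⟦ M ⊛ K ⟧ h) x     ≡⟨ ⟦⟧-⊛ L (M ⊛ K) h x ⟨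
  ⟦ L ⊛ (M ⊛ K) ⟧ h x       ∎
  where open ≡-Reasoning

⊛-identityˡ : ∀ L → (0 ∷ []) ⊛ L ≈ₛ L
⊛-identityˡ L h x =
  trans (⟦⟧-++ (map (0 +_) L) [] h x) (trans (+-identityʳ _) (trans (⟦⟧-map-+ 0 L h x) (cong (⟦ L ⟧ h) (+-identityʳ x))))

⊛-identityʳ : ∀ L → L ⊛ (0 ∷ []) ≈ₛ L
⊛-identityʳ L h x = trans (⟦⟧-⊛ L (0 ∷ []) h x) (⟦⟧-cong L (λ y → trans (+-identityʳ _) (cong h (+-identityʳ y))) x)

⊛-distribˡ : ∀ L M K → L ⊛ (M ++ K) ≈ₛ L ⊛ M ++ L ⊛ K
⊛-distribˡ L M K h x = begin
  ⟦ L ⊛ (M ++ K) ⟧ h x                      ≡⟨ ⟦⟧-⊛ L (M ++ K) h x ⟩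
  ⟦ L ⟧ (⟦ M ++ K ⟧ h) x                    ≡⟨ ⟦⟧-cong L (⟦⟧-++ M K h) x ⟩
  ⟦ L ⟧ (λ y → ⟦ M ⟧ h y + ⟦ K ⟧ h y) x     ≡⟨ ⟦⟧-+ L (⟦ M ⟧ h) (⟦ K ⟧ h) x ⟩
  ⟦ L ⟧ (⟦ M ⟧ h) x + ⟦ L ⟧ (⟦ K ⟧ h) x     ≡⟨ cong₂ _+_ (⟦⟧-⊛ L M h x) (⟦⟧-⊛ L K h x) ⟨
  ⟦ L ⊛ M ⟧ h x + ⟦ L ⊛ K ⟧ h x             ≡⟨ ⟦⟧-++ (L ⊛ M) (L ⊛ K) h x ⟨
  ⟦ L ⊛ M ++ L ⊛ K ⟧ h x                    ∎
  where open ≡-Reasoning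

⊛-distribʳ : ∀ L M K → (M ++ K) ⊛ L ≈ₛ M ⊛ L ++ K ⊛ L
⊛-distribʳ L M K h x = begin
  ⟦ (M ++ K) ⊛ L ⟧ h x                      ≡⟨ ⟦⟧-⊛ (M ++ K) L h x ⟩
  ⟦ M ++ K ⟧ (⟦ L ⟧ h) x                    ≡⟨ ⟦⟧-++ M K (⟦ L ⟧ h) x ⟩
  ⟦ M ⟧ (⟦ L ⟧ h) x + ⟦ K ⟧ (⟦ L ⟧ h) x     ≡⟨ cong₂ _+_ (⟦⟧-⊛ M L h x) (⟦⟧-⊛ K L h x) ⟨
  ⟦ M ⊛ L ⟧ h x + ⟦ K ⊛ L ⟧ h x             ≡⟨ ⟦⟧-++ (M ⊛ L) (K ⊛ L) h x ⟨
  ⟦ M ⊛ L ++ K ⊛ L ⟧ h x                    ∎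
  where open ≡-Reasoning

⊛-zeroʳ : ∀ L → L ⊛ [] ≈ₛ []
⊛-zeroʳ L h x = trans (⟦⟧-⊛ L [] h x) (trans (⟦⟧-const L 0 x) (*-zeroʳ (length L)))

shiftSemiring : Semiring 0ℓ 0ℓ
shiftSemiring = record
  { Carrier    = Shifts
  ; _≈_        = _≈ₛ_
  ; _+_        = _++_
  ; _*_        = _⊛_
  ; 0#         = []
  ; 1#         = 0 ∷ []
  ; isSemiring = record
    { isSemiringWithoutAnnihilatingZero = record
      { +-isCommutativeMonoid = record
        { isMonoid = record
          { isSemigroup = record
            { isMagma = record
              { isEquivalence = record
                { refl  = λ h x → refl
                ; sym   = λ L≈M h x → sym (L≈M h x)
                ; trans = λ L≈M M≈K h x → trans (L≈M h x) (M≈K h x)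
                }
              ; ∙-cong = λ {L} {L′} {M} {M′} → ++-cong-≈ₛ {L} {L′} {M} {M′}
              }
            ; assoc = λ L M K h x → cong (λ N → ⟦ N ⟧ h x) (++-assoc L M K)
            }
          ; identity = (λ L h x → refl) , (λ L h x → cong (λ N → ⟦ N ⟧ h x) (++-identityʳ L))
          }
        ; comm = ++-comm-≈ₛ
        }
      ; *-cong     = λ {L} {L′} {M} {M′} → ⊛-cong {L} {L′} {M} {M′}
      ; *-assoc    = ⊛-assoc
      ; *-identity = ⊛-identityˡ , ⊛-identityʳ
      ; distrib    = ⊛-distribˡ , ⊛-distribʳ
      }
    ; zero = (λ L h x → refl) , ⊛-zeroʳ
    }
  }

open import Algebra.Properties.Semiring.Mult shiftSemiring using () renaming (_×_ to _×ₛ_)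
open import Algebra.Properties.Semiring.Exp shiftSemiring using () renaming (_^_ to _^ₛ_)

⟦⟧-× : ∀ k L h x → ⟦ k ×ₛ L ⟧ h x ≡ k * ⟦ L ⟧ h x
⟦⟧-× zero    L h x = refl
⟦⟧-× (suc k) L h x = trans (⟦⟧-++ L (k ×ₛ L) h x) (cong (⟦ L ⟧ h x +_) (⟦⟧-× k L h x))

⟦⟧-^-singleton : ∀ t k h x → ⟦ (t ∷ []) ^ₛ k ⟧ h x ≡ h (x + k * t)
⟦⟧-^-singleton t zero    h x = +-identityʳ _
⟦⟧-^-singleton t (suc k) h x = begin
  ⟦ (t ∷ []) ⊛ (t ∷ []) ^ₛ k ⟧ h x     ≡⟨ ⟦⟧-⊛ (t ∷ []) ((t ∷ []) ^ₛ k) h x ⟩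
  ⟦ (t ∷ []) ^ₛ k ⟧ h (x + t) + 0      ≡⟨ +-identityʳ _ ⟩
  ⟦ (t ∷ []) ^ₛ k ⟧ h (x + t)          ≡⟨ ⟦⟧-^-singleton t k h (x + t) ⟩
  h (x + t + k * t)                    ≡⟨ cong h (+-assoc x t (k * t)) ⟩
  h (x + suc k * t)                    ∎
  where open ≡-Reasoning

⟦⟧-^-tile : ∀ L {φ} → (∀ y → ⟦ L ⟧ φ y ≡ 1) → ∀ k x → ⟦ L ^ₛ suc k ⟧ φ x ≡ length L ^ k
⟦⟧-^-tile L {φ} tile zero    x = trans (⊛-identityʳ L φ x) (tile x)
⟦⟧-^-tile L {φ} tile (suc k) x = begin
  ⟦ L ⊛ L ^ₛ suc k ⟧ φ x                ≡⟨ ⟦⟧-⊛ L (L ^ₛ suc k) φ x ⟩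
  ⟦ L ⟧ (⟦ L ^ₛ suc k ⟧ φ) x            ≡⟨ ⟦⟧-cong L (⟦⟧-^-tile L tile k) x ⟩
  ⟦ L ⟧ (λ _ → length L ^ k) x          ≡⟨ ⟦⟧-const L _ x ⟩
  length L * length L ^ k               ∎
  where open ≡-Reasoning

singleton-comm : ∀ t L → (t ∷ []) ⊛ L ≈ₛ L ⊛ (t ∷ [])
singleton-comm t L h x = begin
  ⟦ (t ∷ []) ⊛ L ⟧ h x                   ≡⟨ ⟦⟧-⊛ (t ∷ []) L h x ⟩
  ⟦ L ⟧ h (x + t) + 0                    ≡⟨ +-identityʳ _ ⟩
  ⟦ L ⟧ h (x + t)                        ≡⟨ ⟦⟧-translate L h t x ⟨
  ⟦ L ⟧ (λ y → h (y + t)) x              ≡⟨ ⟦⟧-cong L (λ y → sym (+-identityʳ _)) x ⟩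
  ⟦ L ⟧ (⟦ t ∷ [] ⟧ h) x                 ≡⟨ ⟦⟧-⊛ L (t ∷ []) h x ⟨
  ⟦ L ⊛ (t ∷ []) ⟧ h x                   ∎
  where open ≡-Reasoning

⟦⟧-++-× : ∀ L k z h x → ⟦ L ++ k ×ₛ z ⟧ h x ≡ ⟦ L ⟧ h x + k * ⟦ z ⟧ h x
⟦⟧-++-× L k z h x = trans (⟦⟧-++ L (k ×ₛ z) h x) (cong (⟦ L ⟧ h x +_) (⟦⟧-× k z h x))

frobenius : ∀ {p} → Prime p → ∀ L → ∃[ z ] L ^ₛ p ≈ₛ map (p *_) L ++ p ×ₛ z
frobenius {suc q} pr []      = [] , λ h x → sym (trans (⟦⟧-× (suc q) [] h x) (*-zeroʳ (suc q)))
frobenius {p}     pr (t ∷ L) with freshmans-dream shiftSemiring (singleton-comm t L) pr | frobenius pr L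
... | z , [t+L]^p≈ | z′ , L^p≈ = z′ ++ z , t∷L^p≈
  where
  t∷L^p≈ : (t ∷ L) ^ₛ p ≈ₛ map (p *_) (t ∷ L) ++ p ×ₛ (z′ ++ z)
  t∷L^p≈ h x = begin
    ⟦ (t ∷ L) ^ₛ p ⟧ h x                                    ≡⟨ [t+L]^p≈ h x ⟩
    ⟦ ((t ∷ []) ^ₛ p ++ L ^ₛ p) ++ p ×ₛ z ⟧ h x             ≡⟨ ⟦⟧-++-× ((t ∷ []) ^ₛ p ++ L ^ₛ p) p z h x ⟩
    ⟦ (t ∷ []) ^ₛ p ++ L ^ₛ p ⟧ h x + p * Z                 ≡⟨ cong (_+ p * Z) (⟦⟧-++ ((t ∷ []) ^ₛ p) (L ^ₛ p) h x) ⟩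
    ⟦ (t ∷ []) ^ₛ p ⟧ h x + ⟦ L ^ₛ p ⟧ h x + p * Z          ≡⟨ cong₂ (λ a b → a + b + p * Z) (⟦⟧-^-singleton t p h x) ⟦L^p⟧ ⟩
    h (x + p * t) + (⟦ map (p *_) L ⟧ h x + p * Z′) + p * Z ≡⟨ regroup (h (x + p * t)) (⟦ map (p *_) L ⟧ h x) p Z′ Z ⟩
    ⟦ map (p *_) (t ∷ L) ⟧ h x + p * (Z′ + Z)               ≡⟨ cong (λ w → ⟦ map (p *_) (t ∷ L) ⟧ h x + p * w) (⟦⟧-++ z′ z h x) ⟨
    ⟦ map (p *_) (t ∷ L) ⟧ h x + p * ⟦ z′ ++ z ⟧ h x        ≡⟨ ⟦⟧-++-× (map (p *_) (t ∷ L)) p (z′ ++ z) h x ⟨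
    ⟦ map (p *_) (t ∷ L) ++ p ×ₛ (z′ ++ z) ⟧ h x            ∎
    where
    open ≡-Reasoning
    Z Z′ : ℕ
    Z = ⟦ z ⟧ h x
    Z′ = ⟦ z′ ⟧ h x
    ⟦L^p⟧ : ⟦ L ^ₛ p ⟧ h x ≡ ⟦ map (p *_) L ⟧ h x + p * Z′
    ⟦L^p⟧ = trans (L^p≈ h x) (⟦⟧-++-× (map (p *_) L) p z′ h x)
    regroup : ∀ a b p c d → a + (b + p * c) + p * d ≡ a + b + p * (c + d)
    regroup = solve-∀

multiple-≤⇒0∨≡ : ∀ {p a} → p ∣ a → a ≤ p → a ≡ 0 ⊎ a ≡ p
multiple-≤⇒0∨≡         (divides zero    refl) _   = inj₁ refl
multiple-≤⇒0∨≡ {p} {a} (divides (suc k) refl) a≤p = inj₂ (≤-antisym a≤p (m≤m+n p (k * p)))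

-- If the translates of a p-element multiset L tile ℕ with a 0/1-valued φ, Frobenius makes
-- ⟦ map (p *_) L ⟧ φ x ≡ ⟦ L ^ₛ p ⟧ φ x ≡ p ^ (p ∸ 1) ≡ 0 modulo p, while it lies between 0 and p.
tile-dilation : ∀ {p φ} → Prime p → ∀ L → length L ≡ p → (∀ y → φ y ≤ 1) → (∀ y → ⟦ L ⟧ φ y ≡ 1) →
                ∀ x → ⟦ map (p *_) L ⟧ φ x ≡ 0 ⊎ ⟦ map (p *_) L ⟧ φ x ≡ p
tile-dilation {p@(suc (suc q))} {φ} pr L ∣L∣≡p φ≤1 tile x with frobenius pr L
... | z , L^p≈ = multiple-≤⇒0∨≡ p∣dilated
                   (subst (⟦ map (p *_) L ⟧ φ x ≤_) (trans (length-map (p *_) L) ∣L∣≡p) (⟦⟧-≤-length (map (p *_) L) φ≤1 x))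
  where
  p∣⟦L^p⟧ : p ∣ ⟦ L ^ₛ p ⟧ φ x
  p∣⟦L^p⟧ = subst (p ∣_) (sym (trans (⟦⟧-^-tile L tile (suc q) x) (cong (_^ suc q) ∣L∣≡p))) (m∣m*n (p ^ q))
  ⟦L^p⟧≡ : ⟦ L ^ₛ p ⟧ φ x ≡ p * ⟦ z ⟧ φ x + ⟦ map (p *_) L ⟧ φ x
  ⟦L^p⟧≡ = trans (L^p≈ φ x) (trans (⟦⟧-++-× (map (p *_) L) p z φ x) (+-comm (⟦ map (p *_) L ⟧ φ x) _))
  p∣dilated : p ∣ ⟦ map (p *_) L ⟧ φ x
  p∣dilated = ∣m+n∣m⇒∣n (subst (p ∣_) ⟦L^p⟧≡ p∣⟦L^p⟧) (m∣m*n (⟦ z ⟧ φ x))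

support : (ℕ → Bool) → ℕ → Shifts
support w zero    = []
support w (suc k) = support w k ++ (if w k then k ∷ [] else [])

⟦⟧-map-support : ∀ w k f h x → ⟦ map f (support w k) ⟧ h x ≡ ∑[ i < k ] 𝟙 (w i) * h (x + f i)
⟦⟧-map-support w zero    f h x = refl
⟦⟧-map-support w (suc k) f h x = begin
  ⟦ map f (support w k ++ last) ⟧ h x                      ≡⟨ cong (λ L → ⟦ L ⟧ h x) (map-++ f (support w k) last) ⟩
  ⟦ map f (support w k) ++ map f last ⟧ h x                ≡⟨ ⟦⟧-++ (map f (support w k)) (map f last) h x ⟩
  ⟦ map f (support w k) ⟧ h x + ⟦ map f last ⟧ h x         ≡⟨ cong₂ _+_ (⟦⟧-map-support w k f h x) ⟦last⟧ ⟩
  (∑[ i < k ] 𝟙 (w i) * h (x + f i)) + 𝟙 (w k) * h (x + f k) ≡⟨ ∑-last k (λ i → 𝟙 (w i) * h (x + f i)) ⟨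
  ∑[ i < suc k ] 𝟙 (w i) * h (x + f i)                     ∎
  where
  open ≡-Reasoning
  last : Shifts
  last = if w k then k ∷ [] else []
  ⟦last⟧ : ⟦ map f last ⟧ h x ≡ 𝟙 (w k) * h (x + f k)
  ⟦last⟧ with w k
  ... | true  = refl
  ... | false = refl

-- ℤ_n is handled through representatives in ℕ: χ S is the n-periodic indicator of S. It is opaque so that
-- S and the argument can be inferred from χ S y.
module Cyclic (n : ℕ) .{{_ : NonZero n}} where

  -- m * y stands for −y (see +-neg-mod).
  m : ℕ
  m = pred n

  opaque
    χ : Subset n → ℕ → Bool
    χ S y = lookup S (y mod n)

  private variable
    S C : Subset n
    x y : ℕ

  toℕ-mod≡% : ∀ y → toℕ (y mod n) ≡ y % n
  toℕ-mod≡% y = toℕ-fromℕ< (m%n<n y n)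

  toℕ-mod : ∀ y → toℕ (y mod n) ≡ y [mod n ]
  toℕ-mod y = ≡-mod-trans (≡⇒≡-mod (toℕ-mod≡% y)) (%-mod y)

  toℕ-mod-< : ∀ {y} → y < n → toℕ (y mod n) ≡ y
  toℕ-mod-< {y} y<n = trans (toℕ-fromℕ< (m%n<n y n)) (m<n⇒m%n≡m y<n)

  mod-toℕ : ∀ (g : Fin n) → toℕ g mod n ≡ g
  mod-toℕ g = toℕ-injective (toℕ-mod-< (toℕ<n g))

  +-neg-mod : ∀ x y → x + (y + m * y) ≡ x [mod n ]
  +-neg-mod x y = ≡-mod-trans (≡⇒≡-mod (cong (x +_) (trans (cong (_* y) (suc-pred n)) (*-comm n y)))) (+-multiple-mod x y)

  opaque
    unfolding χ

    χ-cong : ∀ S {x y} → x ≡ y [mod n ] → χ S x ≡ χ S y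
    χ-cong S (mod-eq eq) = cong (lookup S) (toℕ-injective (trans (toℕ-fromℕ< _) (trans eq (sym (toℕ-fromℕ< _)))))

    ∈⇒χ : ∀ {g} → g ∈ S → χ S (toℕ g) ≡ true
    ∈⇒χ {S} {g} g∈S = trans (cong (lookup S) (mod-toℕ g)) ([]=⇒lookup g∈S)

    χ⇒∈ : χ S y ≡ true → y mod n ∈ S
    χ⇒∈ {S} {y} = lookup⇒[]= (y mod n) S

    χ-tabulate : ∀ f y → χ (tabulate f) y ≡ f (y mod n)
    χ-tabulate f y = lookup∘tabulate f (y mod n)

    ∣∣≡∑χ : ∀ S → ∣ S ∣ ≡ ∑[ i < n ] 𝟙 (χ S i)
    ∣∣≡∑χ S = count-lookup S (λ i → 𝟙 (χ S i)) (λ i → cong (𝟙 ∘ lookup S) (mod-toℕ i))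

    χ-neighbourhood : ∀ S g i → χ (N n S g) i ≡ not (does (g Fin.≟ i mod n)) ∧ χ S (toℕ g + i)
    χ-neighbourhood S g i =
      trans (lookup∘tabulate (λ h → does (adj? n S g h)) (i mod n)) (cong (not (does (g Fin.≟ i mod n)) ∧_) (begin
        does (g ⊕[ n ] (i mod n) ∈? S)    ≡⟨ does-∈? _ S ⟩
        χ S (toℕ g + toℕ (i mod n))       ≡⟨ χ-cong S (+-congˡ-mod (toℕ g) (toℕ-mod i)) ⟩
        χ S (toℕ g + i)                   ∎))
      where open ≡-Reasoning

    ∣N∩C∣≡∑ : ∀ S C g → ∣ N n S g ∩ C ∣ ≡ ∑[ i < n ] 𝟙 (χ (N n S g) i) * 𝟙 (χ C i)
    ∣N∩C∣≡∑ S C g = trans (∣∣≡∑χ (N n S g ∩ C))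
      (∑-cong n (λ i _ → trans (cong 𝟙 (lookup-zipWith _∧_ (i mod n) (N n S g) C)) (𝟙-∧ (χ (N n S g) i) (χ C i))))

  χ-periodic : ∀ S x → χ S (x + n) ≡ χ S x
  χ-periodic S x = χ-cong S (+-modulus-mod x)

  ∑χ-translate : ∀ S k → ∑[ i < n ] 𝟙 (χ S (k + i)) ≡ ∣ S ∣
  ∑χ-translate S k = begin
    ∑[ i < n ] 𝟙 (χ S (k + i))    ≡⟨ ∑-cong n (λ i _ → cong (𝟙 ∘ χ S) (+-comm k i)) ⟩
    ∑[ i < n ] 𝟙 (χ S (i + k))    ≡⟨ ∑-periodic-shift n (𝟙 ∘ χ S) (cong 𝟙 ∘ χ-periodic S) k ⟩
    ∑[ i < n ] 𝟙 (χ S i)          ≡⟨ ∣∣≡∑χ S ⟨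
    ∣ S ∣                         ∎
    where open ≡-Reasoning

  Loopless : Subset n → Set
  Loopless S = ∀ y → χ S (y + y) ≡ false

  regular⇒loopless : Regular n S ∣ S ∣ → Loopless S
  regular⇒loopless {S} reg y = begin
    χ S (y + y)                  ≡⟨ χ-cong S (+-cong-mod (≡-mod-sym (toℕ-mod y)) (≡-mod-sym (toℕ-mod y))) ⟩
    χ S (toℕ g + toℕ g)          ≡⟨ 𝟙≡0⇒false (trans G≡F F≡0) ⟩
    false                        ∎
    where
    open ≡-Reasoning
    g : Fin n
    g = y mod n
    F G : ℕ → ℕ
    F i = 𝟙 (χ (N n S g) i)
    G i = 𝟙 (χ S (toℕ g + i))
    F≤G : ∀ i → i < n → F i ≤ G i
    F≤G i _ = subst (_≤ G i) (cong 𝟙 (sym (χ-neighbourhood S g i))) (𝟙-∧-≤ (not (does (g Fin.≟ i mod n))) _)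
    ∑F≡∑G : ∑ n F ≡ ∑ n G
    ∑F≡∑G = trans (sym (∣∣≡∑χ (N n S g))) (trans (reg g) (sym (∑χ-translate S (toℕ g))))
    G≡F : G (toℕ g) ≡ F (toℕ g)
    G≡F = sym (∑-pointwise-≡ n F≤G ∑F≡∑G (toℕ g) (toℕ<n g))
    F≡0 : F (toℕ g) ≡ 0
    F≡0 = cong 𝟙 (trans (χ-neighbourhood S g (toℕ g))
                        (cong (λ b → not b ∧ χ S (toℕ g + toℕ g)) (dec-true (g Fin.≟ toℕ g mod n) (sym (mod-toℕ g)))))

  module _ {S : Subset n} (loopless : Loopless S) where

    χ-N-loopless : ∀ g i → χ (N n S g) i ≡ χ S (toℕ g + i)
    χ-N-loopless g i = trans (χ-neighbourhood S g i) (drop-self-test (g Fin.≟ i mod n))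
      where
      drop-self-test : (g≟i : Dec (g ≡ i mod n)) → not (does g≟i) ∧ χ S (toℕ g + i) ≡ χ S (toℕ g + i)
      drop-self-test (no _)    = refl
      drop-self-test (yes g≡i) = sym (trans (χ-cong S g+i≡i+i) (loopless i))
        where
        g+i≡i+i : toℕ g + i ≡ i + i [mod n ]
        g+i≡i+i = +-cong-mod (≡-mod-trans (≡⇒≡-mod (cong toℕ g≡i)) (toℕ-mod i)) ≡-mod-refl

    ∣N∩C∣≡∑-loopless : ∀ C g → ∣ N n S g ∩ C ∣ ≡ ∑[ i < n ] 𝟙 (χ S (toℕ g + i)) * 𝟙 (χ C i)
    ∣N∩C∣≡∑-loopless C g = trans (∣N∩C∣≡∑ S C g) (∑-cong n (λ i _ → cong (λ b → 𝟙 b * 𝟙 (χ C i)) (χ-N-loopless g i)))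

    even⇒∉ : ∀ {t} → t ≡ 0 [mod 2 ] → χ S t ≡ false
    even⇒∉ {t} even = begin
      χ S t                    ≡⟨ cong (χ S) (even⇒[t/2]*2≡t even) ⟨
      χ S (t / 2 * 2)          ≡⟨ cong (χ S) (trans (*-suc (t / 2) 1) (cong (t / 2 +_) (*-identityʳ (t / 2)))) ⟩
      χ S (t / 2 + t / 2)      ≡⟨ loopless (t / 2) ⟩
      false                    ∎
      where open ≡-Reasoning

    ∈⇒odd : ∀ {t} → χ S t ≡ true → t ≡ 1 [mod 2 ]
    ∈⇒odd {t} t∈S with even-or-odd t
    ... | inj₂ odd  = odd
    ... | inj₁ even with trans (sym t∈S) (even⇒∉ even)
    ...   | ()

    ∈⇒n-even : ∀ {s} → χ S s ≡ true → n ≡ 0 [mod 2 ]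
    ∈⇒n-even {s} s∈S with even-or-odd n
    ... | inj₁ even = even
    ... | inj₂ odd with trans (sym s∈S) (trans (sym (χ-periodic S s)) (even⇒∉ (odd+odd (∈⇒odd s∈S) odd)))
    ...   | ()

  -- Q abstracts a subgroup containing S − S: along a walk from g, the endpoint k satisfies Q (k − g)
  -- after an even number of edges and Q (k + g − s₀) after an odd number.
  module _ {S : Subset n} (Q : ℕ → Set)
           (Q-cong : ∀ {a b} → a ≡ b [mod n ] → Q a → Q b)
           (Q-+ : ∀ {a b} → Q a → Q b → Q (a + b))
           (Q-diff : ∀ {a b} → a < n → b < n → χ S a ≡ true → χ S b ≡ true → Q (b + m * a))
           {s₀} (s₀<n : s₀ < n) (s₀∈S : χ S s₀ ≡ true) where

    walk-invariant : ∀ {g k} → Reach n S g k → Q (toℕ k + m * toℕ g) ⊎ Q (toℕ k + toℕ g + m * s₀)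
    walk-invariant {g} here =
      inj₁ (Q-cong (≡-mod-trans (+-neg-mod 0 s₀) (≡-mod-sym (+-neg-mod 0 (toℕ g)))) (Q-diff s₀<n s₀<n s₀∈S s₀∈S))
    walk-invariant {g} {k} (step {h = h} (_ , g+h∈S) walk) =
      swap (Sum.map prepend-to-even prepend-to-odd (walk-invariant walk))
      where
      open import Relation.Binary.Reasoning.Setoid (≡-mod-setoid {n})
      s : ℕ
      s = toℕ (g ⊕[ n ] h)
      s<n : s < n
      s<n = toℕ<n (g ⊕[ n ] h)
      s∈S : χ S s ≡ true
      s∈S = ∈⇒χ g+h∈S
      s≡g+h : s ≡ toℕ g + toℕ h [mod n ]
      s≡g+h = toℕ-mod (toℕ g + toℕ h)
      prepend-to-even : Q (toℕ k + m * toℕ h) → Q (toℕ k + toℕ g + m * s₀)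
      prepend-to-even Q[k-h] = Q-cong (begin
        toℕ k + m * toℕ h + (s + m * s₀)                  ≈⟨ +-congˡ-mod (toℕ k + m * toℕ h) (+-congʳ-mod (m * s₀) s≡g+h) ⟩
        toℕ k + m * toℕ h + (toℕ g + toℕ h + m * s₀)       ≡⟨ regroup (toℕ k) (toℕ g) (toℕ h) m s₀ ⟩
        toℕ k + toℕ g + m * s₀ + (toℕ h + m * toℕ h)       ≈⟨ +-neg-mod _ (toℕ h) ⟩
        toℕ k + toℕ g + m * s₀                             ∎) (Q-+ Q[k-h] (Q-diff s₀<n s<n s₀∈S s∈S))
        where
        regroup : ∀ k g h m s₀ → k + m * h + (g + h + m * s₀) ≡ k + g + m * s₀ + (h + m * h)
        regroup = solve-∀
      prepend-to-odd : Q (toℕ k + toℕ h + m * s₀) → Q (toℕ k + m * toℕ g)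
      prepend-to-odd Q[k+h-s₀] = Q-cong (begin
        toℕ k + toℕ h + m * s₀ + (s₀ + m * s)                   ≈⟨ +-congˡ-mod (toℕ k + toℕ h + m * s₀) (+-congˡ-mod s₀ (*-congˡ-mod m s≡g+h)) ⟩
        toℕ k + toℕ h + m * s₀ + (s₀ + m * (toℕ g + toℕ h))     ≡⟨ regroup (toℕ k) (toℕ g) (toℕ h) m s₀ ⟩
        toℕ k + m * toℕ g + (toℕ h + m * toℕ h) + (s₀ + m * s₀) ≈⟨ +-neg-mod _ s₀ ⟩
        toℕ k + m * toℕ g + (toℕ h + m * toℕ h)                 ≈⟨ +-neg-mod _ (toℕ h) ⟩
        toℕ k + m * toℕ g                                       ∎) (Q-+ Q[k+h-s₀] (Q-diff s<n s₀<n s∈S s₀∈S))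
        where
        regroup : ∀ k g h m s₀ → k + h + m * s₀ + (s₀ + m * (g + h)) ≡ k + m * g + (h + m * h) + (s₀ + m * s₀)
        regroup = solve-∀

module TotalPerfectCode⇒DistinctResidues
  (n p : ℕ) .{{_ : NonZero n}} .{{_ : NonZero p}} (S : Subset n) (pr : Prime p) (p-odd : p ≡ 1 [mod 2 ])
  (∣S∣≡p : ∣ S ∣ ≡ p) (loopless : Cyclic.Loopless n S) (connected : Connected n S)
  (C : Subset n) (code : IsTotalPerfectCode n S C) where

  open Cyclic n

  φ : ℕ → ℕ
  φ y = 𝟙 (χ C y)

  -- The code condition at the vertex g = −x, reindexed by i = x + s.
  tiling : ∀ x → ∑[ s < n ] 𝟙 (χ S s) * φ (x + s) ≡ 1
  tiling x = begin
    ∑[ s < n ] F s                          ≡⟨ ∑-periodic-shift n F F-periodic (m * x) ⟨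
    ∑[ i < n ] F (i + m * x)                ≡⟨ ∑-cong n (λ i _ → cong₂ (λ u v → 𝟙 u * 𝟙 v) (χ-cong S (i+mx≡g+i i)) (χ-cong C (x+[i+mx]≡i i))) ⟩
    ∑[ i < n ] 𝟙 (χ S (toℕ g + i)) * φ i    ≡⟨ ∣N∩C∣≡∑-loopless loopless C g ⟨
    ∣ N n S g ∩ C ∣                         ≡⟨ code g ⟩
    1                                       ∎
    where
    open ≡-Reasoning
    g : Fin n
    g = (m * x) mod n
    F : ℕ → ℕ
    F s = 𝟙 (χ S s) * φ (x + s)
    F-periodic : ∀ s → F (s + n) ≡ F s
    F-periodic s = cong₂ (λ u v → 𝟙 u * 𝟙 v) (χ-periodic S s) (trans (cong (χ C) (sym (+-assoc x s n))) (χ-periodic C (x + s)))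
    i+mx≡g+i : ∀ i → i + m * x ≡ toℕ g + i [mod n ]
    i+mx≡g+i i = ≡-mod-trans (≡⇒≡-mod (+-comm i (m * x))) (+-congʳ-mod i (≡-mod-sym (toℕ-mod (m * x))))
    x+[i+mx]≡i : ∀ i → x + (i + m * x) ≡ i [mod n ]
    x+[i+mx]≡i i = ≡-mod-trans (≡⇒≡-mod (regroup x i m)) (+-neg-mod i x)
      where
      regroup : ∀ x i m → x + (i + m * x) ≡ i + (x + m * x)
      regroup = solve-∀

  elements : Shifts
  elements = support (χ S) n

  ⟦elements⟧ : ∀ h x → ⟦ elements ⟧ h x ≡ ∑[ s < n ] 𝟙 (χ S s) * h (x + s)
  ⟦elements⟧ h x = trans (cong (λ L → ⟦ L ⟧ h x) (sym (map-id elements))) (⟦⟧-map-support (χ S) n id h x)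

  ∑χ≡p : ∑[ s < n ] 𝟙 (χ S s) ≡ p
  ∑χ≡p = trans (sym (∣∣≡∑χ S)) ∣S∣≡p

  ∣elements∣≡p : length elements ≡ p
  ∣elements∣≡p = begin
    length elements                         ≡⟨ *-identityʳ _ ⟨
    length elements * 1                     ≡⟨ ⟦⟧-const elements 1 0 ⟨
    ⟦ elements ⟧ (λ _ → 1) 0                ≡⟨ ⟦elements⟧ (λ _ → 1) 0 ⟩
    ∑[ s < n ] 𝟙 (χ S s) * 1                ≡⟨ ∑-cong n (λ s _ → *-identityʳ _) ⟩
    ∑[ s < n ] 𝟙 (χ S s)                    ≡⟨ ∑χ≡p ⟩
    p                                       ∎
    where open ≡-Reasoning

  Period : ℕ → Set
  Period t = ∀ c → χ C c ≡ true → χ C (c + t) ≡ true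

  dilated-difference-period : ∀ {a b} → a < n → b < n → χ S a ≡ true → χ S b ≡ true → Period (p * (b + m * a))
  dilated-difference-period {a} {b} a<n b<n a∈S b∈S c c∈C =
    subst (λ y → χ C y ≡ true) (regroup c m p a b) (𝟙≡1⇒true φ[x+pb]≡1)
    where
    x : ℕ
    x = c + m * (p * a)
    M : ℕ → ℕ
    M s = 𝟙 (χ S s) * φ (x + p * s)
    ∑M≡⟦⟧ : ∑ n M ≡ ⟦ map (p *_) elements ⟧ φ x
    ∑M≡⟦⟧ = sym (⟦⟧-map-support (χ S) n (p *_) φ x)
    x+pa≡c : x + p * a ≡ c [mod n ]
    x+pa≡c = ≡-mod-trans (≡⇒≡-mod (trans (+-assoc c _ (p * a)) (cong (c +_) (+-comm _ (p * a))))) (+-neg-mod c (p * a))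
    Ma≡1 : M a ≡ 1
    Ma≡1 = cong₂ (λ u v → 𝟙 u * 𝟙 v) a∈S (trans (χ-cong C x+pa≡c) c∈C)
    ∑M≡p : ∑ n M ≡ p
    ∑M≡p with tile-dilation pr elements ∣elements∣≡p (𝟙≤1 ∘ χ C) (λ y → trans (⟦elements⟧ φ y) (tiling y)) x
    ... | inj₁ ⟦⟧≡0 = contradiction (subst (1 ≤_) (trans ∑M≡⟦⟧ ⟦⟧≡0) (subst (_≤ ∑ n M) Ma≡1 (term≤∑ n M a<n))) λ ()
    ... | inj₂ ⟦⟧≡p = trans ∑M≡⟦⟧ ⟦⟧≡p
    Mb≡1 : M b ≡ 1
    Mb≡1 = trans (∑-pointwise-≡ n (λ s _ → 𝟙*≤𝟙 (χ S s) (𝟙≤1 (χ C (x + p * s)))) (trans ∑M≡p (sym ∑χ≡p)) b b<n)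
                 (cong 𝟙 b∈S)
    φ[x+pb]≡1 : φ (x + p * b) ≡ 1
    φ[x+pb]≡1 = trans (sym (+-identityʳ _)) (subst (λ u → 𝟙 u * φ (x + p * b) ≡ 1) b∈S Mb≡1)
    regroup : ∀ c m p a b → c + m * (p * a) + p * b ≡ c + p * (b + m * a)
    regroup = solve-∀

  some-element : ∃[ s₀ ] s₀ < n × χ S s₀ ≡ true
  some-element with ∑-positive n (𝟙 ∘ χ S) (subst (0 <_) (sym ∑χ≡p) (>-nonZero⁻¹ p))
  ... | s₀ , s₀<n , positive = s₀ , s₀<n , 𝟙>0⇒true positive

  s₀ : ℕ
  s₀ = proj₁ some-element

  s₀<n : s₀ < n
  s₀<n = proj₁ (proj₂ some-element)

  s₀∈S : χ S s₀ ≡ true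
  s₀∈S = proj₂ (proj₂ some-element)

  2∣n : 2 ∣ n
  2∣n = ≡0-mod⇒∣ (∈⇒n-even loopless s₀∈S)

  m-odd : m ≡ 1 [mod 2 ]
  m-odd = mod-eq (%-pred-≡0 {m} {2} (trans (cong (_% 2) (suc-pred n)) (%-eq (∈⇒n-even loopless s₀∈S))))

  -- The parity component is what lets D-2 rule out an odd walk from 0 to 2.
  D : ℕ → Set
  D t = Period (p * t) × t ≡ 0 [mod 2 ]

  D-cong : ∀ {a b} → a ≡ b [mod n ] → D a → D b
  D-cong {a} {b} a≡b (period , even) =
    (λ c c∈C → trans (χ-cong C (+-congˡ-mod c (*-congˡ-mod p (≡-mod-sym a≡b)))) (period c c∈C)) ,
    ≡-mod-trans (divisor-mod 2∣n (≡-mod-sym a≡b)) even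

  D-+ : ∀ {a b} → D a → D b → D (a + b)
  D-+ {a} {b} (period-a , even-a) (period-b , even-b) =
    (λ c c∈C → subst (λ y → χ C y ≡ true) (regroup c p a b) (period-b (c + p * a) (period-a c c∈C))) ,
    +-cong-mod even-a even-b
    where
    regroup : ∀ c p a b → c + p * a + p * b ≡ c + p * (a + b)
    regroup = solve-∀

  D-0 : D 0
  D-0 = (λ c c∈C → subst (λ y → χ C y ≡ true) (sym (trans (cong (c +_) (*-zeroʳ p)) (+-identityʳ c))) c∈C) , ≡-mod-refl

  D-* : ∀ {a} → D a → ∀ k → D (k * a)
  D-* Da zero    = D-0
  D-* Da (suc k) = D-+ Da (D-* Da k)

  D-difference : ∀ {a b} → a < n → b < n → χ S a ≡ true → χ S b ≡ true → D (b + m * a)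
  D-difference a<n b<n a∈S b∈S =
    dilated-difference-period a<n b<n a∈S b∈S , odd+odd (∈⇒odd loopless b∈S) (odd*odd m-odd (∈⇒odd loopless a∈S))

  D-2 : D 2
  D-2 with walk-invariant D D-cong D-+ D-difference s₀<n s₀∈S (connected (0 mod n) (2 mod n))
  ... | inj₁ D[2-0]     =
    D-cong (+-cong-mod (toℕ-mod 2) (≡-mod-trans (*-congˡ-mod m (toℕ-mod 0)) (≡⇒≡-mod (*-zeroʳ m)))) D[2-0]
  ... | inj₂ (_ , even) = contradiction (≡-mod-trans (≡-mod-sym even) odd) λ ()
    where
    odd : toℕ (2 mod n) + toℕ (0 mod n) + m * s₀ ≡ 1 [mod 2 ]
    odd = ≡-mod-trans (divisor-mod 2∣n (+-congʳ-mod (m * s₀) (+-cong-mod (toℕ-mod 2) (toℕ-mod 0))))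
                      (≡-mod-trans (+-congˡ-mod 2 (odd*odd m-odd (∈⇒odd loopless s₀∈S))) (mod-eq refl))

  same-residue-difference-period : ∀ {a b} → a ≤ b → χ S a ≡ true → χ S b ≡ true → a ≡ b [mod p ] → Period (b ∸ a)
  same-residue-difference-period {a} {b} a≤b a∈S b∈S a≡b with ≡-mod⇒∣∸ a≡b
  ... | divides k b∸a≡kp =
    subst Period (trans (*-comm p (k / 2 * 2)) (trans (cong (_* p) (even⇒[t/2]*2≡t k-even)) (sym b∸a≡kp)))
          (proj₁ (D-* D-2 (k / 2)))
    where
    open import Relation.Binary.Reasoning.Setoid (≡-mod-setoid {2})
    b∸a-even : b ∸ a ≡ 0 [mod 2 ]
    b∸a-even with even-or-odd (b ∸ a)
    ... | inj₁ even = even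
    ... | inj₂ odd  = contradiction (begin
      1               ≈⟨ ∈⇒odd loopless b∈S ⟨
      b               ≡⟨ m+[n∸m]≡n a≤b ⟨
      a + (b ∸ a)     ≈⟨ odd+odd (∈⇒odd loopless a∈S) odd ⟩
      0               ∎) λ ()
    k-even : k ≡ 0 [mod 2 ]
    k-even = begin
      k               ≡⟨ *-identityʳ k ⟨
      k * 1           ≈⟨ *-congˡ-mod k p-odd ⟨
      k * p           ≡⟨ b∸a≡kp ⟨
      b ∸ a           ≈⟨ b∸a-even ⟩
      0               ∎

  some-code-vertex : ∃[ c₀ ] χ C c₀ ≡ true
  some-code-vertex with ∑-positive n (λ s → 𝟙 (χ S s) * φ (0 + s)) (subst (0 <_) (sym (tiling 0)) z<s)
  ... | c₀ , _ , positive = c₀ , proj₂ (𝟙*𝟙>0⇒true (χ S c₀) (χ C c₀) positive)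

  no-two-in-residue-class : ∀ {a b} → a < b → b < n → χ S a ≡ true → χ S b ≡ true → a ≡ b [mod p ] → ⊥
  no-two-in-residue-class {a} {b} a<b b<n a∈S b∈S a≡b = <-irrefl refl (begin-strict
    1                   <⟨ s≤s (s≤s z≤n) ⟩
    2                   ≡⟨ cong₂ _+_ (F≡1 a∈S x+a∈C) (F≡1 b∈S x+b∈C) ⟨
    F a + F b           ≤⟨ two-terms≤∑ n F a<b b<n ⟩
    ∑ n F               ≡⟨ tiling x ⟩
    1                   ∎)
    where
    open ≤-Reasoning
    c₀ x : ℕ
    c₀ = proj₁ some-code-vertex
    x = c₀ + m * a
    F : ℕ → ℕ
    F s = 𝟙 (χ S s) * φ (x + s)
    F≡1 : ∀ {s} → χ S s ≡ true → χ C (x + s) ≡ true → F s ≡ 1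
    F≡1 s∈S x+s∈C = cong₂ (λ u v → 𝟙 u * 𝟙 v) s∈S x+s∈C
    x+a≡c₀ : x + a ≡ c₀ [mod n ]
    x+a≡c₀ = ≡-mod-trans (≡⇒≡-mod (trans (+-assoc c₀ (m * a) a) (cong (c₀ +_) (+-comm (m * a) a)))) (+-neg-mod c₀ a)
    x+a∈C : χ C (x + a) ≡ true
    x+a∈C = trans (χ-cong C x+a≡c₀) (proj₂ some-code-vertex)
    x+b∈C : χ C (x + b) ≡ true
    x+b∈C = subst (λ y → χ C y ≡ true) (trans (+-assoc x a (b ∸ a)) (cong (x +_) (m+[n∸m]≡n (<⇒≤ a<b))))
                  (same-residue-difference-period (<⇒≤ a<b) a∈S b∈S a≡b (x + a) x+a∈C)

  distinct-residues : ∀ (s s′ : Fin n) → s ∈ S → s′ ∈ S → s ≢ s′ → toℕ s % p ≢ toℕ s′ % p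
  distinct-residues s s′ s∈S s′∈S s≢s′ s≡s′ with <-cmp (toℕ s) (toℕ s′)
  ... | tri< s<s′ _ _ = no-two-in-residue-class s<s′ (toℕ<n s′) (∈⇒χ s∈S) (∈⇒χ s′∈S) (mod-eq s≡s′)
  ... | tri≈ _ s≡s′ _ = s≢s′ (toℕ-injective s≡s′)
  ... | tri> _ _ s′<s = no-two-in-residue-class s′<s (toℕ<n s) (∈⇒χ s′∈S) (∈⇒χ s∈S) (mod-eq (sym s≡s′))

module DistinctResidues⇒TotalPerfectCode
  (n p : ℕ) .{{_ : NonZero n}} .{{_ : NonZero p}} (S : Subset n) (p∣n : p ∣ n) (∣S∣≡p : ∣ S ∣ ≡ p)
  (loopless : Cyclic.Loopless n S)
  (distinct : ∀ (s s′ : Fin n) → s ∈ S → s′ ∈ S → s ≢ s′ → toℕ s % p ≢ toℕ s′ % p) where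

  open Cyclic n

  same-residue⇒≡ : ∀ {a b} → a < n → b < n → χ S a ≡ true → χ S b ≡ true → a % p ≡ b % p → a ≡ b
  same-residue⇒≡ {a} {b} a<n b<n a∈S b∈S a≡b with a ≟ b
  ... | yes a≡b = a≡b
  ... | no  a≢b = contradiction (subst₂ (λ u v → u % p ≡ v % p) (sym (toℕ-mod-< a<n)) (sym (toℕ-mod-< b<n)) a≡b)
                    (distinct (a mod n) (b mod n) (χ⇒∈ a∈S) (χ⇒∈ b∈S) (a≢b ∘ toℕ-mod-injective))
    where
    toℕ-mod-injective : a mod n ≡ b mod n → a ≡ b
    toℕ-mod-injective eq = trans (sym (toℕ-mod-< a<n)) (trans (cong toℕ eq) (toℕ-mod-< b<n))

  residue-count : ℕ → ℕ
  residue-count r = ∑[ s < n ] 𝟙 (χ S s) * 𝟙 (does (s % p ≟ r))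

  residue-count≤1 : ∀ r → residue-count r ≤ 1
  residue-count≤1 r = ∑-≤1 n F (λ s _ → ≤-trans (𝟙*≤𝟙 (χ S s) (𝟙≤1 _)) (𝟙≤1 (χ S s))) F-support
    where
    F : ℕ → ℕ
    F s = 𝟙 (χ S s) * 𝟙 (does (s % p ≟ r))
    F-support : ∀ i j → i < n → j < n → 0 < F i → 0 < F j → i ≡ j
    F-support i j i<n j<n Fi>0 Fj>0 with 𝟙*𝟙>0⇒true (χ S i) _ Fi>0 | 𝟙*𝟙>0⇒true (χ S j) _ Fj>0
    ... | i∈S , i≡r | j∈S , j≡r =
      same-residue⇒≡ i<n j<n i∈S j∈S (trans (does⇒ (i % p ≟ r) i≡r) (sym (does⇒ (j % p ≟ r) j≡r)))

  ∑residue-count≡p : ∑[ r < p ] residue-count r ≡ p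
  ∑residue-count≡p = begin
    ∑[ r < p ] ∑[ s < n ] 𝟙 (χ S s) * 𝟙 (does (s % p ≟ r))     ≡⟨ ∑-comm p n _ ⟩
    ∑[ s < n ] ∑[ r < p ] 𝟙 (χ S s) * 𝟙 (does (s % p ≟ r))     ≡⟨ ∑-cong n (λ s _ → ∑-*ˡ p (𝟙 (χ S s)) _) ⟩
    ∑[ s < n ] 𝟙 (χ S s) * (∑[ r < p ] 𝟙 (does (s % p ≟ r)))   ≡⟨ ∑-cong n (λ s _ → cong (𝟙 (χ S s) *_) (one-residue s)) ⟩
    ∑[ s < n ] 𝟙 (χ S s) * 1                                   ≡⟨ ∑-cong n (λ s _ → *-identityʳ _) ⟩
    ∑[ s < n ] 𝟙 (χ S s)                                       ≡⟨ trans (sym (∣∣≡∑χ S)) ∣S∣≡p ⟩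
    p                                                          ∎
    where
    open ≡-Reasoning
    one-residue : ∀ s → ∑[ r < p ] 𝟙 (does (s % p ≟ r)) ≡ 1
    one-residue s = trans (∑-supported p _ (m%n<n s p) (λ r _ r≢s%p → cong 𝟙 (dec-false (s % p ≟ r) (r≢s%p ∘ sym))))
                          (cong 𝟙 (dec-true (s % p ≟ s % p) refl))

  residue-count≡1 : ∀ {r} → r < p → residue-count r ≡ 1
  residue-count≡1 {r} r<p =
    ∑-pointwise-≡ p (λ r _ → residue-count≤1 r) (trans ∑residue-count≡p (sym (trans (∑-const p 1) (*-identityʳ p)))) r r<p

  pℤ : Subset n
  pℤ = tabulate (λ i → does (p ∣? toℕ i))

  χ-pℤ : ∀ i → χ pℤ i ≡ does (p ∣? i)
  χ-pℤ i = begin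
    χ pℤ i                        ≡⟨ χ-tabulate _ i ⟩
    does (p ∣? toℕ (i mod n))    ≡⟨ cong (λ k → does (p ∣? k)) (toℕ-mod≡% i) ⟩
    does (p ∣? i % n)            ≡⟨ does-⇔ (mk⇔ (∣n∣m%n⇒∣m p∣n) (λ p∣i → %-presˡ-∣ p∣i p∣n)) (p ∣? _) (p ∣? i) ⟩
    does (p ∣? i)                ∎
    where open ≡-Reasoning

  ∣+neg⇔≡ : ∀ s g → p ∣ s + m * g ⇔ s % p ≡ g % p
  ∣+neg⇔≡ s g = mk⇔ to from
    where
    to : p ∣ s + m * g → s % p ≡ g % p
    to p∣s-g = %-eq (begin
      s                       ≈⟨ divisor-mod p∣n (+-neg-mod s g) ⟨
      s + (g + m * g)         ≡⟨ regroup s g m ⟩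
      s + m * g + g           ≈⟨ +-congʳ-mod g (∣⇒≡0-mod p∣s-g) ⟩
      g                       ∎)
      where
      open import Relation.Binary.Reasoning.Setoid (≡-mod-setoid {p})
      regroup : ∀ s g m → s + (g + m * g) ≡ s + m * g + g
      regroup = solve-∀
    from : s % p ≡ g % p → p ∣ s + m * g
    from s≡g = ≡0-mod⇒∣ (≡-mod-trans (+-congʳ-mod (m * g) (mod-eq s≡g)) (divisor-mod p∣n (+-neg-mod 0 g)))

  pℤ-is-code : IsTotalPerfectCode n S pℤ
  pℤ-is-code g = begin
    ∣ N n S g ∩ pℤ ∣                ≡⟨ ∣N∩C∣≡∑-loopless loopless pℤ g ⟩
    ∑[ i < n ] F i                 ≡⟨ ∑-periodic-shift n F F-periodic (m * toℕ g) ⟨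
    ∑[ s < n ] F (s + m * toℕ g)   ≡⟨ ∑-cong n (λ s _ → F[s-g]≡ s) ⟩
    residue-count (toℕ g % p)      ≡⟨ residue-count≡1 (m%n<n (toℕ g) p) ⟩
    1                              ∎
    where
    open ≡-Reasoning
    F : ℕ → ℕ
    F i = 𝟙 (χ S (toℕ g + i)) * 𝟙 (χ pℤ i)
    F-periodic : ∀ i → F (i + n) ≡ F i
    F-periodic i = cong₂ (λ u v → 𝟙 u * 𝟙 v) (χ-cong S (+-congˡ-mod (toℕ g) (+-modulus-mod i))) (χ-periodic pℤ i)
    g+[s-g]≡s : ∀ s → toℕ g + (s + m * toℕ g) ≡ s [mod n ]
    g+[s-g]≡s s = ≡-mod-trans (≡⇒≡-mod (regroup (toℕ g) s m)) (+-neg-mod s (toℕ g))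
      where
      regroup : ∀ g s m → g + (s + m * g) ≡ s + (g + m * g)
      regroup = solve-∀
    F[s-g]≡ : ∀ s → F (s + m * toℕ g) ≡ 𝟙 (χ S s) * 𝟙 (does (s % p ≟ toℕ g % p))
    F[s-g]≡ s = cong₂ (λ u v → 𝟙 u * 𝟙 v) (χ-cong S (g+[s-g]≡s s))
                      (trans (χ-pℤ _) (does-⇔ (∣+neg⇔≡ s (toℕ g)) (p ∣? _) (s % p ≟ toℕ g % p)))

theorem3p6 : (n p : ℕ) .{{_ : NonZero n}} .{{_ : NonZero p}} →
    Prime p → p % 2 ≡ 1 → p ∣ n →
    (S : Subset n) → ∣ S ∣ ≡ p → Connected n S → Regular n S p →
    HasTotalPerfectCode n S ⇔
    (∀ (s s′ : Fin n) → s ∈ S → s′ ∈ S → s ≢ s′ → toℕ s % p ≢ toℕ s′ % p)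
theorem3p6 n p pr p-odd p∣n S ∣S∣≡p connected regular =
  mk⇔ (λ (C , code) → distinct-residues C code) (λ distinct → pℤ distinct , pℤ-is-code distinct)
  where
  loopless : Cyclic.Loopless n S
  loopless = Cyclic.regular⇒loopless n (subst (Regular n S) (sym ∣S∣≡p) regular)
  open TotalPerfectCode⇒DistinctResidues n p S pr (mod-eq p-odd) ∣S∣≡p loopless connected using (distinct-residues)
  open DistinctResidues⇒TotalPerfectCode n p S p∣n ∣S∣≡p loopless using (pℤ; pℤ-is-code)
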